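{- Let $\mathcal{A}=(S,E,\rho,\pi,\rhd)$ be an explicit sequential algorithm of sort $U,V$ which is computable. Then the induced partial function $f_{\mathcal{A}}:U\to V$ is partial computable.
   Context: An explicit sequential algorithm of sort $U,V$ is a tuple $(S,E,\rho,\pi,\rhd)$ where $S$ is a set of states, $E\subseteq S$ is a set of end states, $\rhd:S\to S$ is a partial function, $\rho:U\to S$ is an input map and $\pi:S\to V$ an output map. A run is a sequence $s_0,\dots,s_n$ with $s_{i+1}=\rhd(s_i)$ and $s_i\notin E$ for $i<n$; write $s\rhd^\ast t$ if there is a run from $s$ to $t$. The induced partial function is $f_{\mathcal{A}}(u):=\pi(t)$ if $\rho(u)\rhd^\ast t\in E$, undefined otherwise. $\mathcal{A}$ is computable if, relative to some representations of $U$, $V$ and $S$, the functions $\rho,\pi$ are computable, $\rhd$ is partial computable, and membership in $E$ is decidable. -}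

module Defs where

open import Level using (Level; _⊔_)
open import Data.Nat using (ℕ; zero; suc; _<_)
open import Data.Fin using (Fin)
open import Data.Vec using (Vec; []; _∷_; lookup)
open import Data.Product using (Σ; _×_; _,_; ∃)
open import Data.Sum using (_⊎_)
open import Relation.Nullary using (¬_)
open import Relation.Binary.PropositionalEquality using (_≡_)

data PR : ℕ → Set where
  zer  : PR 0
  succ : PR 1
  proj : ∀ {k} → Fin k → PR k
  comp : ∀ {m k} → PR m → Vec (PR k) m → PR k
  prim : ∀ {k} → PR k → PR (suc (suc k)) → PR (suc k)
  mu   : ∀ {k} → PR (suc k) → PR k

mutual
  data Eval : ∀ {k} → PR k → Vec ℕ k → ℕ → Set where
    ev-zer  : Eval zer [] 0
    ev-succ : ∀ x → Eval succ (x ∷ []) (suc x)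
    ev-proj : ∀ {k} (i : Fin k) (xs : Vec ℕ k) → Eval (proj i) xs (lookup xs i)
    ev-comp : ∀ {m k} {f : PR m} {gs : Vec (PR k) m} {xs : Vec ℕ k} {ys : Vec ℕ m} {y : ℕ}
            → EvalVec gs xs ys → Eval f ys y → Eval (comp f gs) xs y
    ev-prim-zero : ∀ {k} {g : PR k} {h : PR (suc (suc k))} {xs : Vec ℕ k} {y : ℕ}
            → Eval g xs y → Eval (prim g h) (0 ∷ xs) y
    ev-prim-suc : ∀ {k} {g : PR k} {h : PR (suc (suc k))} {xs : Vec ℕ k} {n r y : ℕ}
            → Eval (prim g h) (n ∷ xs) r → Eval h (n ∷ r ∷ xs) y
            → Eval (prim g h) (suc n ∷ xs) y
    ev-mu : ∀ {k} {f : PR (suc k)} {xs : Vec ℕ k} {y : ℕ}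
            → Eval f (y ∷ xs) 0
            → (∀ z → z < y → Σ ℕ λ w → Eval f (z ∷ xs) (suc w))
            → Eval (mu f) xs y

  data EvalVec : ∀ {m k} → Vec (PR k) m → Vec ℕ k → Vec ℕ m → Set where
    ev-[] : ∀ {k} {xs : Vec ℕ k} → EvalVec [] xs []
    ev-∷  : ∀ {m k} {g : PR k} {gs : Vec (PR k) m} {xs : Vec ℕ k} {y : ℕ} {ys : Vec ℕ m}
          → Eval g xs y → EvalVec gs xs ys → EvalVec (g ∷ gs) xs (y ∷ ys)

record PartialFn {a b ℓ} (A : Set a) (B : Set b) : Set (a ⊔ b ⊔ Level.suc ℓ) where
  field
    graph      : A → B → Set ℓ
    functional : ∀ {x y z} → graph x y → graph x z → y ≡ z
open PartialFn public

record Representation {a} (A : Set a) : Set a where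
  field
    code       : ℕ → A
    surjective : ∀ x → Σ ℕ λ n → code n ≡ x
open Representation public

IsPartialComputable : ∀ {ℓ} {A B : Set}
  → Representation A → Representation B → (A → B → Set ℓ) → Set ℓ
IsPartialComputable δA δB F =
  Σ (PR 1) λ e → ∀ (n : ℕ) (y : _) → F (code δA n) y →
    Σ ℕ λ m → Eval e (n ∷ []) m × code δB m ≡ y

IsComputable : ∀ {A B : Set}
  → Representation A → Representation B → (A → B) → Set
IsComputable δA δB f = IsPartialComputable δA δB (λ x y → f x ≡ y)

IsDecidable : ∀ {ℓ} {A : Set} → Representation A → (A → Set ℓ) → Set ℓ
IsDecidable δA P =
  Σ (PR 1) λ e → ∀ (n : ℕ) →
    (Eval e (n ∷ []) 1 × P (code δA n)) ⊎ (Eval e (n ∷ []) 0 × ¬ P (code δA n))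

record ExplicitSeqAlg {ℓ} (U V : Set) : Set (Level.suc (Level.suc ℓ)) where
  field
    S    : Set
    E    : S → Set ℓ
    step : PartialFn {ℓ = ℓ} S S
    ρ    : U → S
    π    : S → V
open ExplicitSeqAlg public

module _ {ℓ} {U V : Set} (𝒜 : ExplicitSeqAlg {ℓ} U V) where
  data Run : S 𝒜 → S 𝒜 → Set ℓ where
    run-done : ∀ {s} → Run s s
    run-step : ∀ {s s′ t} → ¬ E 𝒜 s → graph (step 𝒜) s s′ → Run s′ t → Run s t

  f-graph : U → V → Set ℓ
  f-graph u v = Σ (S 𝒜) λ t → Run (ρ 𝒜 u) t × E 𝒜 t × π 𝒜 t ≡ v

  IsComputableAlg : Representation U → Representation V → Representation (S 𝒜) → Set ℓ
  IsComputableAlg δU δV δS =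
      IsComputable δU δS (ρ 𝒜)
    × IsComputable δS δV (π 𝒜)
    × IsPartialComputable δS δS (graph (step 𝒜))
    × IsDecidable δS (E 𝒜)

{-# OPTIONS --safe #-}
module Submission where

open import Defs
open import Data.Product using (Σ; _×_; _,_; proj₁; proj₂)
open import Data.Sum using (inj₁; inj₂)
open import Data.Nat using (ℕ; zero; suc; _<_; _≤_; z≤n)
open import Data.Nat.Properties using (m≤n⇒m<n∨m≡n; <⇒≱)
open import Data.Fin using () renaming (zero to fz; suc to fs)
open import Data.Vec using (Vec; []; _∷_)
open import Data.Empty using (⊥-elim)
open import Relation.Binary.PropositionalEquality using (_≡_; refl; sym; trans; cong; subst)

-- Iterating the step program i times on (a name of) the initial state yields the i-th state of the
-- run; unbounded minimisation finds the first i at which the end-state test succeeds, and the output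
-- program is applied to that state. Since a run passes through no end state before its last one,
-- a terminating run makes the minimisation stop exactly at its final state.

ev-comp₁ : ∀ {k} {f : PR 1} {g : PR k} {xs : Vec ℕ k} {y z : ℕ}
         → Eval g xs y → Eval f (y ∷ []) z → Eval (comp f (g ∷ [])) xs z
ev-comp₁ g⇓ f⇓ = ev-comp (ev-∷ g⇓ ev-[]) f⇓

isZero : PR 1
isZero = prim (comp succ (zer ∷ [])) (comp zer [])

isZero-zero : Eval isZero (0 ∷ []) 1
isZero-zero = ev-prim-zero (ev-comp₁ ev-zer (ev-succ 0))

mutual
  isZero-suc : ∀ n → Eval isZero (suc n ∷ []) 0
  isZero-suc n = ev-prim-suc (proj₂ (isZero-total n)) (ev-comp ev-[] ev-zer)

  isZero-total : ∀ n → Σ ℕ λ r → Eval isZero (n ∷ []) r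
  isZero-total zero    = 1 , isZero-zero
  isZero-total (suc n) = 0 , isZero-suc n

module Iteration (init next halt out : PR 1) where

  iterate : PR 2
  iterate = prim init (comp next (proj (fs fz) ∷ []))

  -- Negated, because μ searches for a zero: the value is 0 exactly when the i-th state has halted.
  running : PR 2
  running = comp isZero (comp halt (iterate ∷ []) ∷ [])

  runUntilHalt : PR 1
  runUntilHalt = comp out (comp iterate (mu running ∷ proj fz ∷ []) ∷ [])

  module _ {n : ℕ} where

    iterate-zero : ∀ {m} → Eval init (n ∷ []) m → Eval iterate (0 ∷ n ∷ []) m
    iterate-zero = ev-prim-zero

    iterate-suc : ∀ {i m m′} → Eval iterate (i ∷ n ∷ []) m → Eval next (m ∷ []) m′
                → Eval iterate (suc i ∷ n ∷ []) m′
    iterate-suc {i} {m} it⇓ next⇓ = ev-prim-suc it⇓ (ev-comp₁ (ev-proj (fs fz) (i ∷ m ∷ n ∷ [])) next⇓)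

    running-halted : ∀ {i m k} → Eval iterate (i ∷ n ∷ []) m → Eval halt (m ∷ []) (suc k)
                   → Eval running (i ∷ n ∷ []) 0
    running-halted {k = k} it⇓ halt⇓ = ev-comp₁ (ev-comp₁ it⇓ halt⇓) (isZero-suc k)

    running-active : ∀ {i m} → Eval iterate (i ∷ n ∷ []) m → Eval halt (m ∷ []) 0
                   → Eval running (i ∷ n ∷ []) 1
    running-active it⇓ halt⇓ = ev-comp₁ (ev-comp₁ it⇓ halt⇓) isZero-zero

    runUntilHalt-eval : ∀ {i m v} → Eval iterate (i ∷ n ∷ []) m → Eval running (i ∷ n ∷ []) 0
                      → (∀ z → z < i → Σ ℕ λ w → Eval running (z ∷ n ∷ []) (suc w))
                      → Eval out (m ∷ []) v → Eval runUntilHalt (n ∷ []) v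
    runUntilHalt-eval it⇓ halted active out⇓ =
      ev-comp₁ (ev-comp (ev-∷ (ev-mu halted active) (ev-∷ (ev-proj fz (n ∷ [])) ev-[])) it⇓) out⇓

module RunSearch {ℓ} {U V : Set} (𝒜 : ExplicitSeqAlg {ℓ} U V) (δS : Representation (S 𝒜))
                 (init out : PR 1)
                 (stepC : IsPartialComputable δS δS (graph (step 𝒜)))
                 (endC : IsDecidable δS (E 𝒜)) where

  open Iteration init (proj₁ stepC) (proj₁ endC) out public

  record FirstHalt (n j : ℕ) (t : S 𝒜) : Set where
    field
      index         : ℕ
      state         : ℕ
      iterate-index : Eval iterate (index ∷ n ∷ []) state
      state-decodes : code δS state ≡ t
      halted        : Eval running (index ∷ n ∷ []) 0
      active-before : ∀ z → j ≤ z → z < index → Σ ℕ λ w → Eval running (z ∷ n ∷ []) (suc w)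

  firstHalt-here : ∀ {n j m} → Eval iterate (j ∷ n ∷ []) m → Eval (proj₁ endC) (m ∷ []) 1
                 → FirstHalt n j (code δS m)
  firstHalt-here {j = j} {m} it⇓ end⇓ = record
    { index         = j
    ; state         = m
    ; iterate-index = it⇓
    ; state-decodes = refl
    ; halted        = running-halted it⇓ end⇓
    ; active-before = λ z j≤z z<j → ⊥-elim (<⇒≱ z<j j≤z)
    }

  firstHalt-later : ∀ {n j w t} → Eval running (j ∷ n ∷ []) (suc w) → FirstHalt n (suc j) t
                  → FirstHalt n j t
  firstHalt-later {n} {j} {w} active later = record
    { index         = index
    ; state         = state
    ; iterate-index = iterate-index
    ; state-decodes = state-decodes
    ; halted        = halted
    ; active-before = active-from-j
    }
    where
    open FirstHalt later
    active-from-j : ∀ z → j ≤ z → z < index → Σ ℕ λ w → Eval running (z ∷ n ∷ []) (suc w)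
    active-from-j z j≤z z<i with m≤n⇒m<n∨m≡n j≤z
    ... | inj₁ j<z  = active-before z j<z z<i
    ... | inj₂ refl = w , active

  run⇒firstHalt : ∀ {n j m t} → Eval iterate (j ∷ n ∷ []) m → Run 𝒜 (code δS m) t → E 𝒜 t
                → FirstHalt n j t
  run⇒firstHalt {m = m} it⇓ run-done t∈E with proj₂ endC m
  ... | inj₁ (end⇓ , _)    = firstHalt-here it⇓ end⇓
  ... | inj₂ (_ , t∉E)     = ⊥-elim (t∉E t∈E)
  run⇒firstHalt {m = m} it⇓ (run-step s∉E s▹s′ rest) t∈E with proj₂ endC m
  ... | inj₁ (_ , s∈E)     = ⊥-elim (s∉E s∈E)
  ... | inj₂ (end⇓ , _) with proj₂ stepC m _ s▹s′
  ... | m′ , step⇓ , refl  =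
    firstHalt-later (running-active it⇓ end⇓) (run⇒firstHalt (iterate-suc it⇓ step⇓) rest t∈E)

proposition3p9 : ∀ {ℓ} {U V : Set} (𝒜 : ExplicitSeqAlg {ℓ} U V)
    → (δU : Representation U) (δV : Representation V)
    → Σ (Representation (S 𝒜)) (λ δS → IsComputableAlg 𝒜 δU δV δS)
    → IsPartialComputable δU δV (f-graph 𝒜)
proposition3p9 𝒜 δU δV (δS , (init , init-correct) , (out , out-correct) , stepC , endC) =
  runUntilHalt , computes
  where
  open RunSearch 𝒜 δS init out stepC endC

  computes : ∀ n y → f-graph 𝒜 (code δU n) y
           → Σ ℕ λ v → Eval runUntilHalt (n ∷ []) v × code δV v ≡ y
  computes n y (t , run , t∈E , πt≡y) with init-correct n _ refl
  ... | m₀ , init⇓ , m₀-decodes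
    with run⇒firstHalt (iterate-zero init⇓) (subst (λ s → Run 𝒜 s t) (sym m₀-decodes) run) t∈E
  ... | record { state = m ; iterate-index = it⇓ ; state-decodes = m-decodes
               ; halted = halted ; active-before = active } with out-correct m _ refl
  ... | v , out⇓ , v-decodes =
    v , runUntilHalt-eval it⇓ halted (λ z → active z z≤n) out⇓ ,
    trans v-decodes (trans (cong (π 𝒜) m-decodes) πt≡y)
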